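{- Let $\mathbb{C}$ be a nonempty simplicial complex of dimension $n\ge 1$. The operators $\delta^{\uparrow\downarrow}$ and $\varepsilon^{\uparrow\downarrow}$ map subcomplexes of $\mathbb{C}$ to subcomplexes of $\mathbb{C}$, and they form an adjunction on the lattice of subcomplexes of $\mathbb{C}$ ordered by inclusion: for all subcomplexes $X,Y$ of $\mathbb{C}$, $\delta^{\uparrow\downarrow}(X)\subseteq Y\iff X\subseteq\varepsilon^{\uparrow\downarrow}(Y)$.
   Context: A simplex is a finite nonempty set; its dimension is its cardinality minus one. A simplicial complex is a set of simplices such that every nonempty subset of an element belongs to it; a subcomplex of $\mathbb{C}$ is a subset of $\mathbb{C}$ that is a simplicial complex. For $X\subseteq\mathbb{C}$, $X_i$ is the set of $i$-simplices of $X$ and $\mathbb{C}_i$ the set of $i$-simplices of $\mathbb{C}$. For $0\le a<b\le n$, $X\subseteq\mathbb{C}_a$, $Y\subseteq \mathbb{C}_b$: $\delta^+_{a,b}(X)=\{x\in\mathbb{C}_b:\exists y\in X,\ y\subseteq x\}$, $\varepsilon^+_{a,b}(X)=\{x\in\mathbb{C}_b:\forall y\in\mathbb{C}_a,\ y\subseteq x\Rightarrow y\in X\}$, $\delta^-_{b,a}(Y)=\{x\in\mathbb{C}_a:\exists y\in Y,\ x\subseteq y\}$, $\varepsilon^-_{b,a}(Y)=\{x\in\mathbb{C}_a:\forall y\in\mathbb{C}_b,\ x\subseteq y\Rightarrow y\in Y\}$. $Cl(X)=\bigcup_{x\in X}\{y: y\subseteq x,\ y\ne\emptyset\}$ for $X\subseteq\mathbb{C}$,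 and $Cl^\dagger$ is its adjoint erosion: $Cl^\dagger(X)=\bigcup\{Y\subseteq\mathbb{C}: Cl(Y)\subseteq X\}$. For a subcomplex $X$ of $\mathbb{C}$ (composition by juxtaposition): $\delta^{\uparrow\downarrow}(X)=\bigcup_{i=0}^{n-1}\delta^-_{i+1,i}\delta^+_{i,i+1}(X_i)\ \cup\ \delta^+_{n-1,n}\delta^-_{n,n-1}(X_n)$, $\varepsilon^{\uparrow\downarrow}(X)=Cl^\dagger\Big(\bigcup_{i=0}^{n-1}\varepsilon^-_{i+1,i}\varepsilon^+_{i,i+1}(X_i)\ \cup\ \varepsilon^+_{n-1,n}\varepsilon^-_{n,n-1}(X_n)\Big)$. -}

module Defs where

open import Level using (Level; _⊔_; suc; 0ℓ)
open import Data.Nat using (ℕ; zero; _≤_; _<_; _∸_) renaming (suc to 1+)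
open import Data.Fin.Subset using (Subset; Nonempty; ∣_∣) renaming (_⊆_ to _⊆ₛ_)
open import Data.Product using (Σ; ∃; _×_; _,_)
open import Data.Sum using (_⊎_)
open import Relation.Binary.PropositionalEquality using (_≡_)
open import Relation.Unary using (Pred; _⊆_)

-- Vertices are Fin m; a simplex is a nonempty Subset m (finite set of vertices).
-- The dimension of a simplex x is ∣ x ∣ - 1, i.e. x is an i-simplex iff ∣ x ∣ ≡ 1+ i.

SSet : ℕ → (ℓ : Level) → Set (suc ℓ)
SSet m ℓ = Pred (Subset m) ℓ

module _ {m : ℕ} where

  IsComplex : ∀ {ℓ} → SSet m ℓ → Set ℓ
  IsComplex K = (∀ x → K x → Nonempty x)
              × (∀ x y → K x → Nonempty y → y ⊆ₛ x → K y)

  IsSubcomplex : ∀ {ℓ ℓ'} → SSet m ℓ → SSet m ℓ' → Set (ℓ ⊔ ℓ')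
  IsSubcomplex C X = (X ⊆ C) × IsComplex X

  HasDim : ∀ {ℓ} → SSet m ℓ → ℕ → Set ℓ
  HasDim C n = (∀ x → C x → ∣ x ∣ ≤ 1+ n) × (∃ λ x → C x × ∣ x ∣ ≡ 1+ n)

  module Ops (C : SSet m 0ℓ) where

    dimPart : ∀ {ℓ} → SSet m ℓ → ℕ → SSet m ℓ
    dimPart X i x = X x × ∣ x ∣ ≡ 1+ i

    δ⁺ : ∀ {ℓ} → ℕ → ℕ → SSet m ℓ → SSet m ℓ
    δ⁺ a b X x = (C x × ∣ x ∣ ≡ 1+ b) × ∃ λ y → X y × y ⊆ₛ x

    ε⁺ : ∀ {ℓ} → ℕ → ℕ → SSet m ℓ → SSet m ℓ
    ε⁺ a b X x = (C x × ∣ x ∣ ≡ 1+ b) × (∀ y → C y → ∣ y ∣ ≡ 1+ a → y ⊆ₛ x → X y)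

    δ⁻ : ∀ {ℓ} → ℕ → ℕ → SSet m ℓ → SSet m ℓ
    δ⁻ b a Y x = (C x × ∣ x ∣ ≡ 1+ a) × ∃ λ y → Y y × x ⊆ₛ y

    ε⁻ : ∀ {ℓ} → ℕ → ℕ → SSet m ℓ → SSet m ℓ
    ε⁻ b a Y x = (C x × ∣ x ∣ ≡ 1+ a) × (∀ y → C y → ∣ y ∣ ≡ 1+ b → x ⊆ₛ y → Y y)

    Cl : ∀ {ℓ} → SSet m ℓ → SSet m ℓ
    Cl X y = ∃ λ x → X x × (y ⊆ₛ x × Nonempty y)

    Cl† : ∀ {ℓ} → SSet m ℓ → SSet m (suc 0ℓ ⊔ ℓ)
    Cl† X z = Σ (SSet m 0ℓ) λ Y → (Y ⊆ C) × (Cl Y ⊆ X) × Y z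

    δ↑↓ : ℕ → SSet m 0ℓ → SSet m 0ℓ
    δ↑↓ n X x =
      (Σ ℕ λ i → i < n × δ⁻ (1+ i) i (δ⁺ i (1+ i) (dimPart X i)) x)
      ⊎ δ⁺ (n ∸ 1) n (δ⁻ n (n ∸ 1) (dimPart X n)) x

    ε↑↓ : ℕ → SSet m 0ℓ → SSet m (suc 0ℓ)
    ε↑↓ n X = Cl† λ x →
      (Σ ℕ λ i → i < n × ε⁻ (1+ i) i (ε⁺ i (1+ i) (dimPart X i)) x)
      ⊎ ε⁺ (n ∸ 1) n (ε⁻ n (n ∸ 1) (dimPart X n)) x

module Submission where

-- The adjunction is assembled from elementary Galois connections.
-- Between a- and b-simplices we have δ⁺ ⊣ ε⁻ and δ⁻ ⊣ ε⁺, so the composites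
-- building δ↑↓ (δ⁻δ⁺ in each dimension i < n, δ⁺δ⁻ at the top dimension n)
-- are left adjoint to the composites building ε↑↓ before the erosion Cl†.
-- Since a subcomplex X of ℂ is the disjoint union of its parts X_0, …, X_n,
-- and both sides of the adjunction split along dimension, this gives
-- δ↑↓ X ⊆ Y ⇔ X ⊆ ε↑↓-raw Y; finally, for a subcomplex X, X ⊆ Cl† E ⇔ X ⊆ E.
-- That ε↑↓ X is a subcomplex holds for Cl† E with any E.  That δ↑↓ X is a
-- subcomplex rests on a counting fact: if a simplex y of ℂ has a facet z in X,
-- every proper j-face w of y lies below some (j+1)-face v of y that contains a
-- j-simplex of X (namely j+1 vertices of v ∩ z, which misses at most one
-- vertex of v).

open import Defs
open import Level using (0ℓ)
open import Data.Nat using (ℕ; _≤_)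
open import Data.Product using (_×_)
open import Relation.Unary using (_⊆_)
open import Function.Bundles using (_⇔_)

open import Data.Nat using (zero; suc; _<_; _+_; _∸_; z≤n; s≤s)
import Data.Nat.Properties as ℕₚ
open import Data.Vec using ([]; _∷_)
open import Data.Vec.Base using (here)
open import Data.Fin.Subset
  using (Subset; Nonempty; ∣_∣; _∩_; _∪_; _∈_; inside; outside; ⁅_⁆; ⊥)
  renaming (_⊆_ to _⊆ₛ_)
open import Data.Fin.Subset.Properties
  using (_∈?_; drop-∷-⊆; out⊆; s⊆s; ⊥⊆; ⊆-antisym; p⊆q⇒∣p∣≤∣q∣; p⊂q⇒∣p∣<∣q∣; x∈⁅y⁆⇒x≡y;
         ∣⁅x⁆∣≡1; ∣⊥∣≡0; nonempty?; Empty-unique; x∈p∪q⁻; x∈p∩q⁻)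
open import Data.Product using (Σ; ∃; _,_; proj₁; proj₂)
open import Data.Sum using (_⊎_; inj₁; inj₂; [_,_])
open import Function.Bundles using (mk⇔; module Equivalence)
open import Function.Properties.Equivalence using () renaming (trans to ⇔-trans; sym to ⇔-sym)
open import Relation.Nullary using (yes; no; contradiction)
open import Relation.Binary.PropositionalEquality
  using (_≡_; refl; sym; trans; cong; subst; module ≡-Reasoning)

private
  variable
    k : ℕ
    p q r : Subset k

nonempty⇒size : Nonempty p → ∃ λ j → ∣ p ∣ ≡ suc j
nonempty⇒size {p = p} (x , x∈p) with ∣ p ∣ | 1≤∣p∣
  where
    ⁅x⁆⊆p : ⁅ x ⁆ ⊆ₛ p
    ⁅x⁆⊆p y∈⁅x⁆ = subst (_∈ p) (sym (x∈⁅y⁆⇒x≡y x y∈⁅x⁆)) x∈p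
    1≤∣p∣ : 1 ≤ ∣ p ∣
    1≤∣p∣ = subst (_≤ ∣ p ∣) (∣⁅x⁆∣≡1 x) (p⊆q⇒∣p∣≤∣q∣ ⁅x⁆⊆p)
... | suc j | _ = j , refl

size⇒nonempty : ∀ {k j} {p : Subset k} → ∣ p ∣ ≡ suc j → Nonempty p
size⇒nonempty {k = k} {p = p} e with nonempty? p
... | yes ne = ne
... | no empty with () ← trans (sym (∣⊥∣≡0 k)) (subst (λ s → ∣ s ∣ ≡ _) (Empty-unique empty) e)

⊆-of-size≥ : p ⊆ₛ q → ∣ q ∣ ≤ ∣ p ∣ → q ⊆ₛ p
⊆-of-size≥ {p = p} p⊆q q≤p {x} x∈q with x ∈? p
... | yes x∈p = x∈p
... | no  x∉p = contradiction q≤p (ℕₚ.<⇒≱ (p⊂q⇒∣p∣<∣q∣ (p⊆q , x , x∈q , x∉p)))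

∣p∪q∣+∣p∩q∣ : ∀ (p q : Subset k) → ∣ p ∪ q ∣ + ∣ p ∩ q ∣ ≡ ∣ p ∣ + ∣ q ∣
∣p∪q∣+∣p∩q∣ []            []            = refl
∣p∪q∣+∣p∩q∣ (outside ∷ p) (outside ∷ q) = ∣p∪q∣+∣p∩q∣ p q
∣p∪q∣+∣p∩q∣ (inside  ∷ p) (outside ∷ q) = cong suc (∣p∪q∣+∣p∩q∣ p q)
∣p∪q∣+∣p∩q∣ (outside ∷ p) (inside  ∷ q) = begin
  suc (∣ p ∪ q ∣ + ∣ p ∩ q ∣) ≡⟨ cong suc (∣p∪q∣+∣p∩q∣ p q) ⟩
  suc (∣ p ∣ + ∣ q ∣)         ≡⟨ ℕₚ.+-suc (∣ p ∣) (∣ q ∣) ⟨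
  ∣ p ∣ + suc ∣ q ∣           ∎
  where open ≡-Reasoning
∣p∪q∣+∣p∩q∣ (inside  ∷ p) (inside  ∷ q) = cong suc (begin
  ∣ p ∪ q ∣ + suc ∣ p ∩ q ∣   ≡⟨ ℕₚ.+-suc (∣ p ∪ q ∣) (∣ p ∩ q ∣) ⟩
  suc (∣ p ∪ q ∣ + ∣ p ∩ q ∣) ≡⟨ cong suc (∣p∪q∣+∣p∩q∣ p q) ⟩
  suc (∣ p ∣ + ∣ q ∣)         ≡⟨ ℕₚ.+-suc (∣ p ∣) (∣ q ∣) ⟨
  ∣ p ∣ + suc ∣ q ∣           ∎)
  where open ≡-Reasoning

∪-least : p ⊆ₛ r → q ⊆ₛ r → p ∪ q ⊆ₛ r
∪-least {p = p} {q = q} p⊆r q⊆r x∈p∪q = [ p⊆r , q⊆r ] (x∈p∪q⁻ p q x∈p∪q)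

overlap-bound : p ⊆ₛ r → q ⊆ₛ r → ∣ p ∣ + ∣ q ∣ ≤ ∣ p ∩ q ∣ + ∣ r ∣
overlap-bound {p = p} {r = r} {q = q} p⊆r q⊆r = begin
  ∣ p ∣ + ∣ q ∣           ≡⟨ ∣p∪q∣+∣p∩q∣ p q ⟨
  ∣ p ∪ q ∣ + ∣ p ∩ q ∣   ≡⟨ ℕₚ.+-comm (∣ p ∪ q ∣) (∣ p ∩ q ∣) ⟩
  ∣ p ∩ q ∣ + ∣ p ∪ q ∣   ≤⟨ ℕₚ.+-monoʳ-≤ (∣ p ∩ q ∣) (p⊆q⇒∣p∣≤∣q∣ (∪-least p⊆r q⊆r)) ⟩
  ∣ p ∩ q ∣ + ∣ r ∣       ∎
  where open ℕₚ.≤-Reasoning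

interpolate : ∀ (a b : Subset k) c → a ⊆ₛ b → ∣ a ∣ ≤ c → c ≤ ∣ b ∣ →
              ∃ λ d → a ⊆ₛ d × d ⊆ₛ b × ∣ d ∣ ≡ c
interpolate [] [] zero _ _ _ = [] , (λ ()) , (λ ()) , refl
interpolate (inside ∷ a) (outside ∷ b) c a⊆b _ _ with () ← a⊆b here
interpolate (outside ∷ a) (outside ∷ b) c a⊆b a≤c c≤b
  with d , a⊆d , d⊆b , ∣d∣ ← interpolate a b c (drop-∷-⊆ a⊆b) a≤c c≤b
  = outside ∷ d , out⊆ a⊆d , out⊆ d⊆b , ∣d∣
interpolate (inside ∷ a) (inside ∷ b) (suc c) a⊆b (s≤s a≤c) (s≤s c≤b)
  with d , a⊆d , d⊆b , ∣d∣ ← interpolate a b c (drop-∷-⊆ a⊆b) a≤c c≤b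
  = inside ∷ d , s⊆s a⊆d , s⊆s d⊆b , cong suc ∣d∣
interpolate (outside ∷ a) (inside ∷ b) c a⊆b a≤c c≤1+b with c ℕₚ.≤? ∣ b ∣
... | yes c≤b with d , a⊆d , d⊆b , ∣d∣ ← interpolate a b c (drop-∷-⊆ a⊆b) a≤c c≤b
  = outside ∷ d , out⊆ a⊆d , out⊆ d⊆b , ∣d∣
... | no  c≰b = inside ∷ b , out⊆ (drop-∷-⊆ a⊆b) , (λ x∈b → x∈b) ,
                ℕₚ.≤-antisym (ℕₚ.≰⇒> c≰b) c≤1+b

subset-of-size : ∀ (b : Subset k) c → c ≤ ∣ b ∣ → ∃ λ d → d ⊆ₛ b × ∣ d ∣ ≡ c
subset-of-size {k} b c c≤∣b∣
  with d , _ , d⊆b , ∣d∣ ← interpolate ⊥ b c ⊥⊆ (subst (_≤ c) (sym (∣⊥∣≡0 k)) z≤n) c≤∣b∣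
  = d , d⊆b , ∣d∣

facet-overlap : ∀ {v z y : Subset k} → v ⊆ₛ y → z ⊆ₛ y → ∣ y ∣ ≡ suc ∣ z ∣ →
                ∣ v ∣ ≤ suc ∣ v ∩ z ∣
facet-overlap {v = v} {z} {y} v⊆y z⊆y ∣y∣ = ℕₚ.+-cancelʳ-≤ (∣ z ∣) (∣ v ∣) (suc ∣ v ∩ z ∣) (begin
  ∣ v ∣ + ∣ z ∣           ≤⟨ overlap-bound v⊆y z⊆y ⟩
  ∣ v ∩ z ∣ + ∣ y ∣       ≡⟨ cong (∣ v ∩ z ∣ +_) ∣y∣ ⟩
  ∣ v ∩ z ∣ + suc ∣ z ∣   ≡⟨ ℕₚ.+-suc (∣ v ∩ z ∣) (∣ z ∣) ⟩
  suc ∣ v ∩ z ∣ + ∣ z ∣   ∎)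
  where open ℕₚ.≤-Reasoning

dimension-cases : ∀ {n} → Nonempty p → ∣ p ∣ ≤ suc n →
                  (∃ λ i → i < n × ∣ p ∣ ≡ suc i) ⊎ ∣ p ∣ ≡ suc n
dimension-cases ne ∣p∣≤1+n with nonempty⇒size ne
... | i , ∣p∣ with ℕₚ.m≤n⇒m<n∨m≡n (ℕₚ.≤-pred (subst (_≤ _) ∣p∣ ∣p∣≤1+n))
...   | inj₁ i<n = inj₁ (i , i<n , ∣p∣)
...   | inj₂ refl = inj₂ ∣p∣

module _ {m : ℕ} (C : SSet m 0ℓ) where
  open Ops C

  -- The summands of δ↑↓ (dimension i < n, and the top dimension n) and the
  -- corresponding summands of ε↑↓; ε↑↓-raw is ε↑↓ before the erosion Cl†,
  -- so that ε↑↓ n Y is Cl† (ε↑↓-raw n Y) by definition.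
  δ-below ε-below δ-top ε-top : ℕ → SSet m 0ℓ → SSet m 0ℓ
  δ-below i A = δ⁻ (suc i) i (δ⁺ i (suc i) A)
  ε-below i B = ε⁻ (suc i) i (ε⁺ i (suc i) B)
  δ-top n A = δ⁺ (n ∸ 1) n (δ⁻ n (n ∸ 1) A)
  ε-top n B = ε⁺ (n ∸ 1) n (ε⁻ n (n ∸ 1) B)

  ε↑↓-raw : ℕ → SSet m 0ℓ → SSet m 0ℓ
  ε↑↓-raw n Y x = (Σ ℕ λ i → i < n × ε-below i (dimPart Y i) x) ⊎ ε-top n (dimPart Y n) x

  δ⁺⊣ε⁻ : ∀ {a b} {A B : SSet m 0ℓ} → A ⊆ dimPart C a → (δ⁺ a b A ⊆ B ⇔ A ⊆ ε⁻ b a B)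
  δ⁺⊣ε⁻ {a} {b} {A} {B} A⊆Cₐ = mk⇔ unit counit
    where
      unit : δ⁺ a b A ⊆ B → A ⊆ ε⁻ b a B
      unit δA⊆B Ax = A⊆Cₐ Ax , λ y Cy ∣y∣ x⊆y → δA⊆B ((Cy , ∣y∣) , _ , Ax , x⊆y)
      counit : A ⊆ ε⁻ b a B → δ⁺ a b A ⊆ B
      counit A⊆εB ((Cx , ∣x∣) , y , Ay , y⊆x) = proj₂ (A⊆εB Ay) _ Cx ∣x∣ y⊆x

  δ⁻⊣ε⁺ : ∀ {a b} {A B : SSet m 0ℓ} → B ⊆ dimPart C b → (δ⁻ b a B ⊆ A ⇔ B ⊆ ε⁺ a b A)
  δ⁻⊣ε⁺ {a} {b} {A} {B} B⊆C_b = mk⇔ unit counit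
    where
      unit : δ⁻ b a B ⊆ A → B ⊆ ε⁺ a b A
      unit δB⊆A By = B⊆C_b By , λ y Cy ∣y∣ y⊆x → δB⊆A ((Cy , ∣y∣) , _ , By , y⊆x)
      counit : B ⊆ ε⁺ a b A → δ⁻ b a B ⊆ A
      counit B⊆εA ((Cx , ∣x∣) , y , By , x⊆y) = proj₂ (B⊆εA By) _ Cx ∣x∣ x⊆y

  -- Adjunctions compose (the right adjoints in reverse order).
  δ-below⊣ε-below : ∀ {i} {A B : SSet m 0ℓ} → A ⊆ dimPart C i →
                    (δ-below i A ⊆ B ⇔ A ⊆ ε-below i B)
  δ-below⊣ε-below A⊆Cᵢ = ⇔-trans (δ⁻⊣ε⁺ proj₁) (δ⁺⊣ε⁻ A⊆Cᵢ)

  δ-top⊣ε-top : ∀ {n} {A B : SSet m 0ℓ} → A ⊆ dimPart C n → (δ-top n A ⊆ B ⇔ A ⊆ ε-top n B)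
  δ-top⊣ε-top A⊆Cₙ = ⇔-trans (δ⁺⊣ε⁻ proj₁) (δ⁻⊣ε⁺ A⊆Cₙ)

  ⊆-dimPart : ∀ {i} {A Y : SSet m 0ℓ} → A ⊆ dimPart C i → (A ⊆ Y ⇔ A ⊆ dimPart Y i)
  ⊆-dimPart A⊆Cᵢ = mk⇔ (λ A⊆Y {x} Ax → A⊆Y Ax , proj₂ (A⊆Cᵢ Ax)) (λ A⊆Yᵢ {x} Ax → proj₁ (A⊆Yᵢ Ax))

  module _ {X Y : SSet m 0ℓ} (X⊆C : X ⊆ C) where

    dimPart-⊆ : ∀ i → dimPart X i ⊆ dimPart C i
    dimPart-⊆ i (Xx , ∣x∣) = X⊆C Xx , ∣x∣

    below-adjunction : ∀ i →
      δ-below i (dimPart X i) ⊆ Y ⇔ dimPart X i ⊆ ε-below i (dimPart Y i)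
    below-adjunction i = ⇔-trans (⊆-dimPart proj₁) (δ-below⊣ε-below (dimPart-⊆ i))

    top-adjunction : ∀ n →
      δ-top n (dimPart X n) ⊆ Y ⇔ dimPart X n ⊆ ε-top n (dimPart Y n)
    top-adjunction n = ⇔-trans (⊆-dimPart proj₁) (δ-top⊣ε-top (dimPart-⊆ n))

  -- The summands of ε↑↓-raw live in distinct dimensions, so an i-simplex of
  -- ε↑↓-raw comes from the i-th summand.
  ε↑↓-raw-below : ∀ {n i Y x} → i < n → ε↑↓-raw n Y x → ∣ x ∣ ≡ suc i → ε-below i (dimPart Y i) x
  ε↑↓-raw-below i<n (inj₁ (j , _ , εx@((_ , ∣x∣≡1+j) , _))) ∣x∣≡1+i
    with refl ← ℕₚ.suc-injective (trans (sym ∣x∣≡1+j) ∣x∣≡1+i) = εx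
  ε↑↓-raw-below i<n (inj₂ ((_ , ∣x∣≡1+n) , _)) ∣x∣≡1+i
    with refl ← ℕₚ.suc-injective (trans (sym ∣x∣≡1+n) ∣x∣≡1+i) = contradiction i<n (ℕₚ.<-irrefl refl)

  ε↑↓-raw-top : ∀ {n Y x} → ε↑↓-raw n Y x → ∣ x ∣ ≡ suc n → ε-top n (dimPart Y n) x
  ε↑↓-raw-top (inj₁ (i , i<n , (_ , ∣x∣≡1+i) , _)) ∣x∣≡1+n
    with refl ← ℕₚ.suc-injective (trans (sym ∣x∣≡1+i) ∣x∣≡1+n) = contradiction i<n (ℕₚ.<-irrefl refl)
  ε↑↓-raw-top (inj₂ εx) _ = εx

  δ↑↓⊣ε↑↓-raw : ∀ {n} {X Y : SSet m 0ℓ} → (∀ x → C x → ∣ x ∣ ≤ suc n) →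
                X ⊆ C → (∀ x → X x → Nonempty x) → (δ↑↓ n X ⊆ Y ⇔ X ⊆ ε↑↓-raw n Y)
  δ↑↓⊣ε↑↓-raw {n} {X} {Y} bounded X⊆C X-nonempty = mk⇔ unit counit
    where
      open Equivalence
      unit : δ↑↓ n X ⊆ Y → X ⊆ ε↑↓-raw n Y
      unit δX⊆Y {x} Xx with dimension-cases (X-nonempty x Xx) (bounded x (X⊆C Xx))
      ... | inj₁ (i , i<n , ∣x∣) =
        inj₁ (i , i<n , to (below-adjunction X⊆C i) (λ d → δX⊆Y (inj₁ (i , i<n , d))) (Xx , ∣x∣))
      ... | inj₂ ∣x∣ = inj₂ (to (top-adjunction X⊆C n) (λ d → δX⊆Y (inj₂ d)) (Xx , ∣x∣))
      counit : X ⊆ ε↑↓-raw n Y → δ↑↓ n X ⊆ Y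
      counit X⊆εY (inj₁ (i , i<n , d)) =
        from (below-adjunction X⊆C i) (λ (Xx , ∣x∣) → ε↑↓-raw-below i<n (X⊆εY Xx) ∣x∣) d
      counit X⊆εY (inj₂ d) = from (top-adjunction X⊆C n) (λ (Xx , ∣x∣) → ε↑↓-raw-top (X⊆εY Xx) ∣x∣) d

  Cl-⊆ : ∀ {ℓ} {A : SSet m ℓ} → IsComplex C → A ⊆ C → Cl A ⊆ C
  Cl-⊆ (_ , C-closed) A⊆C (x , Ax , y⊆x , y-ne) = C-closed x _ (A⊆C Ax) y-ne y⊆x

  Cl-idempotent : ∀ {ℓ} {A : SSet m ℓ} → Cl (Cl A) ⊆ Cl A
  Cl-idempotent (y , (x , Ax , y⊆x , _) , z⊆y , z-ne) = x , Ax , (λ i → y⊆x (z⊆y i)) , z-ne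

  -- Cl† E is a subcomplex for every E: each member lies in some Y with
  -- Cl Y ⊆ E, and then Cl Y is such a set containing all its faces.
  Cl†-subcomplex : ∀ {ℓ} → IsComplex C → (E : SSet m ℓ) → IsSubcomplex C (Cl† E)
  Cl†-subcomplex C-complex@(C-nonempty , _) E = Cl†E⊆C , Cl†E-nonempty , Cl†E-closed
    where
      Cl†E⊆C : Cl† E ⊆ C
      Cl†E⊆C (_ , A⊆C , _ , Ax) = A⊆C Ax
      Cl†E-nonempty : ∀ x → Cl† E x → Nonempty x
      Cl†E-nonempty x Cl†Ex = C-nonempty x (Cl†E⊆C Cl†Ex)
      Cl†E-closed : ∀ x y → Cl† E x → Nonempty y → y ⊆ₛ x → Cl† E y
      Cl†E-closed x y (A , A⊆C , ClA⊆E , Ax) y-ne y⊆x =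
        Cl A , Cl-⊆ C-complex A⊆C , (λ z → ClA⊆E (Cl-idempotent z)) , (x , Ax , y⊆x , y-ne)

  ⊆Cl†⇔⊆ : ∀ {ℓ} {X : SSet m 0ℓ} {E : SSet m ℓ} → IsSubcomplex C X → (X ⊆ Cl† E ⇔ X ⊆ E)
  ⊆Cl†⇔⊆ {X = X} {E} (X⊆C , X-nonempty , X-closed) = mk⇔ counit unit
    where
      counit : X ⊆ Cl† E → X ⊆ E
      counit X⊆Cl†E {x} Xx with X⊆Cl†E Xx
      ... | _ , _ , ClA⊆E , Ax = ClA⊆E (x , Ax , (λ i → i) , X-nonempty x Xx)
      unit : X ⊆ E → X ⊆ Cl† E
      unit X⊆E Xx = X , X⊆C , (λ (x , Xx , y⊆x , y-ne) → X⊆E (X-closed x _ Xx y-ne y⊆x)) , Xx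

  module _ (C-complex : IsComplex C) {X : SSet m 0ℓ} (X-complex : IsComplex X) where

    -- Extend w to a (j+1)-face v of y;
    -- v ∩ z has ≥ j+1 vertices, any j+1 of which form a j-simplex of X inside v.
    proper-face-below : ∀ {j y z w} → C y → X z → z ⊆ₛ y → ∣ y ∣ ≡ suc ∣ z ∣ →
                        w ⊆ₛ y → ∣ w ∣ ≡ suc j → ∣ w ∣ < ∣ y ∣ → δ-below j (dimPart X j) w
    proper-face-below {j} {y} {z} {w} Cy Xz z⊆y ∣y∣ w⊆y ∣w∣ w<y
      with v , w⊆v , v⊆y , ∣v∣ ← interpolate w y (suc (suc j)) w⊆y
                                   (ℕₚ.≤-trans (ℕₚ.≤-reflexive ∣w∣) (ℕₚ.n≤1+n _))
                                   (subst (λ s → suc s ≤ ∣ y ∣) ∣w∣ w<y)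
      with u , u⊆v∩z , ∣u∣ ← subset-of-size (v ∩ z) (suc j)
                               (ℕₚ.≤-pred (subst (_≤ suc ∣ v ∩ z ∣) ∣v∣ (facet-overlap v⊆y z⊆y ∣y∣)))
      = (Cw , ∣w∣) , v , ((Cv , ∣v∣) , u , (Xu , ∣u∣) , u⊆v) , w⊆v
      where
        Cw : C w
        Cw = proj₂ C-complex y w Cy (size⇒nonempty ∣w∣) w⊆y
        Cv : C v
        Cv = proj₂ C-complex y v Cy (size⇒nonempty ∣v∣) v⊆y
        u⊆v : u ⊆ₛ v
        u⊆v x∈u = proj₁ (x∈p∩q⁻ v z (u⊆v∩z x∈u))
        Xu : X u
        Xu = proj₂ X-complex z u Xz (size⇒nonempty ∣u∣) (λ x∈u → proj₂ (x∈p∩q⁻ v z (u⊆v∩z x∈u)))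

    module _ {n} (bounded : ∀ x → C x → ∣ x ∣ ≤ suc n) (1≤n : 1 ≤ n) where

      -- The same, read as membership in δ↑↓ (proper faces of y have dimension < n).
      below-coface : ∀ {y z w} → C y → X z → z ⊆ₛ y → ∣ y ∣ ≡ suc ∣ z ∣ →
                     Nonempty w → w ⊆ₛ y → ∣ w ∣ < ∣ y ∣ → δ↑↓ n X w
      below-coface {y} Cy Xz z⊆y ∣y∣ w-ne w⊆y w<y with j , ∣w∣ ← nonempty⇒size w-ne =
        inj₁ (j , j<n , proper-face-below Cy Xz z⊆y ∣y∣ w⊆y ∣w∣ w<y)
        where
          j<n : j < n
          j<n = ℕₚ.≤-pred (ℕₚ.≤-trans (subst (λ s → suc s ≤ ∣ y ∣) ∣w∣ w<y) (bounded y Cy))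

      -- δ↑↓ X is closed under faces: a face of a simplex in the i-th summand is a
      -- proper face of the coface y used there; a face of a top simplex x is x
      -- itself or a proper face of x, whose (n-1)-face y lies in X.
      δ↑↓-closed : ∀ x w → δ↑↓ n X x → Nonempty w → w ⊆ₛ x → δ↑↓ n X w
      δ↑↓-closed x w (inj₁ (i , _ , (_ , ∣x∣) , y , ((Cy , ∣y∣) , z , (Xz , ∣z∣) , z⊆y) , x⊆y))
                 w-ne w⊆x =
        below-coface Cy Xz z⊆y (trans ∣y∣ (cong suc (sym ∣z∣))) w-ne (λ a∈w → x⊆y (w⊆x a∈w)) w<y
        where
          w<y : ∣ w ∣ < ∣ y ∣
          w<y = subst (∣ w ∣ <_) (sym ∣y∣)
                  (s≤s (subst (∣ w ∣ ≤_) ∣x∣ (p⊆q⇒∣p∣≤∣q∣ w⊆x)))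
      δ↑↓-closed x w (inj₂ δx@((Cx , ∣x∣) , y , ((_ , ∣y∣) , u , (Xu , _) , y⊆u) , y⊆x))
                 w-ne w⊆x with ℕₚ.m≤n⇒m<n∨m≡n (p⊆q⇒∣p∣≤∣q∣ w⊆x)
      ... | inj₁ w<x = below-coface Cx Xy y⊆x ∣x∣≡1+∣y∣ w-ne w⊆x w<x
        where
          Xy : X y
          Xy = proj₂ X-complex u y Xu (size⇒nonempty ∣y∣) y⊆u
          ∣x∣≡1+∣y∣ : ∣ x ∣ ≡ suc ∣ y ∣
          ∣x∣≡1+∣y∣ = trans ∣x∣ (cong suc (sym (trans ∣y∣ (ℕₚ.m+[n∸m]≡n 1≤n))))
      ... | inj₂ ∣w∣≡∣x∣ with refl ← ⊆-antisym (⊆-of-size≥ w⊆x (ℕₚ.≤-reflexive (sym ∣w∣≡∣x∣))) w⊆x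
        = inj₂ δx

      δ↑↓-subcomplex : IsSubcomplex C (δ↑↓ n X)
      δ↑↓-subcomplex = δ↑↓⊆C , (λ x δx → proj₁ C-complex x (δ↑↓⊆C δx)) , δ↑↓-closed
        where
          δ↑↓⊆C : δ↑↓ n X ⊆ C
          δ↑↓⊆C (inj₁ (_ , _ , (Cx , _) , _)) = Cx
          δ↑↓⊆C (inj₂ ((Cx , _) , _)) = Cx

mainTheorem8 : {m : ℕ} (C : SSet m 0ℓ) (n : ℕ) → IsComplex C → HasDim C n → 1 ≤ n →
    let open Ops C in
    ((X : SSet m 0ℓ) → IsSubcomplex C X → IsSubcomplex C (δ↑↓ n X))
    × ((X : SSet m 0ℓ) → IsSubcomplex C X → IsSubcomplex C (ε↑↓ n X))
    × ((X Y : SSet m 0ℓ) → IsSubcomplex C X → IsSubcomplex C Y →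
    (δ↑↓ n X ⊆ Y) ⇔ (X ⊆ ε↑↓ n Y))
mainTheorem8 C n C-complex (bounded , _) 1≤n =
    (λ X (_ , X-complex) → δ↑↓-subcomplex C C-complex X-complex bounded 1≤n)
  , (λ X _ → Cl†-subcomplex C C-complex (ε↑↓-raw C n X))
  , λ X Y X-sub@(X⊆C , X-nonempty , _) _ →
      ⇔-trans (δ↑↓⊣ε↑↓-raw C bounded X⊆C X-nonempty) (⇔-sym (⊆Cl†⇔⊆ C X-sub))
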